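{- Let $n\ge i\ge 0$ with $i\in\{0,1,2\}$. Then player $B$ has a winning strategy for chomp on $\mathcal{K}_n^0$ when $n\equiv 1\pmod 3$, and for chomp on $\mathcal{K}_n^2$ when $n\equiv 2\pmod 3$; in all other cases (i.e., for $\mathcal{K}_n^i$ with $i\in\{0,1,2\}$ not covered above) player $B$ loses.
   Context: Chomp on a finite graph: two players, $A$ moving first and then $B$, alternately remove either an edge or a vertex together with all its incident edges; the player who cannot move (the graph is empty) loses. For integers $n\ge 0$ and $0\le i_1,\dots,i_k\le n$, the graph $\mathcal{K}_n^{i_1,\dots,i_k}$ consists of a complete graph on vertices $u_1,\dots,u_n$ together with $k$ further vertices $v_{i_1},\dots,v_{i_k}$, where $v_{i_j}$ is adjacent exactly to $u_1,\dots,u_{i_j}$. -}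

module Defs where

open import Data.Nat using (ℕ; _<ᵇ_; _+_)
open import Data.Fin using (Fin; toℕ; splitAt; _≟_)
open import Data.Bool using (Bool; true; false; _∧_; _∨_; not)
open import Data.Sum using (_⊎_; inj₁; inj₂)
open import Data.Vec using (Vec; lookup)
open import Relation.Nullary.Decidable using (⌊_⌋)
open import Relation.Binary.PropositionalEquality using (_≡_)

-- A (simple, undirected) graph state on the vertex universe Fin m:
-- present vertices V, and adjacency E (kept symmetric, irreflexive, and
-- only between present vertices by construction of the moves below).
record Graph (m : ℕ) : Set where
  constructor mkGraph
  field
    V : Fin m → Bool
    E : Fin m → Fin m → Bool
open Graph public

_==_ : ∀ {m} → Fin m → Fin m → Bool
a == b = ⌊ a ≟ b ⌋

delEdge : ∀ {m} → Graph m → Fin m → Fin m → Graph m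
delEdge g x y = mkGraph (V g)
  (λ a b → E g a b ∧ not ((a == x ∧ b == y) ∨ (a == y ∧ b == x)))

delVertex : ∀ {m} → Graph m → Fin m → Graph m
delVertex g x = mkGraph (λ a → V g a ∧ not (a == x))
  (λ a b → E g a b ∧ not (a == x) ∧ not (b == x))

data Move {m : ℕ} (g : Graph m) : Graph m → Set where
  edgeMove   : ∀ x y → E g x y ≡ true → Move g (delEdge g x y)
  vertexMove : ∀ x → V g x ≡ true → Move g (delVertex g x)

-- Win g : the player to move from g has a winning strategy
-- Lose g : the player to move from g loses (opponent has a winning strategy)
-- (normal play: the player who cannot move loses)
mutual
  data Win {m : ℕ} (g : Graph m) : Set where
    win : ∀ {g'} → Move g g' → Lose g' → Win g

  data Lose {m : ℕ} (g : Graph m) : Set where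
    lose : (∀ {g'} → Move g g' → Win g') → Lose g

-- 𝒦_n^{i_1,…,i_k}: vertices Fin (n + k); index j < n is u_{j+1},
-- index n + j is v_{i_(j+1)}, adjacent exactly to u_1,…,u_{i_(j+1)}.
Kadj : ∀ n {k} → Vec ℕ k → Fin (n + k) → Fin (n + k) → Bool
Kadj n is a b with splitAt n a | splitAt n b
... | inj₁ p | inj₁ q = not (p == q)
... | inj₁ p | inj₂ q = toℕ p <ᵇ lookup is q
... | inj₂ p | inj₁ q = toℕ q <ᵇ lookup is p
... | inj₂ p | inj₂ q = false

K : ∀ n {k} → Vec ℕ k → Graph (n + k)
K n is = mkGraph (λ _ → true) (Kadj n is)

-- Two non-adjacent vertices with the same neighbourhood (twins) can be deleted
-- without changing the outcome: whoever wins the smaller position answers every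
-- move at one twin by the mirrored move at the other.  Removing an edge of a clique
-- makes its ends twins, so it acts like removing both ends, and a clique on c
-- vertices is lost by the player to move exactly when 3 ∣ c.  𝒦ₙⁱ is an n-clique
-- with a hub joined to i of its vertices (the spokes).  Removing the hub leaves the
-- n-clique, which settles 3 ∣ n; otherwise removing an edge between two spokes or
-- two non-spokes again creates twins, and induction on n along these reductions
-- decides every case with i ≤ 2.

module Submission where

open import Defs
open import Data.Nat using (ℕ; zero; suc; _+_; _*_; _≤_; _<_; z≤n; s≤s; s≤s⁻¹; _<ᵇ_; _%_)
open import Data.Nat.Properties
  using (≤-refl; ≤-trans; +-mono-≤; +-monoʳ-≤; +-monoˡ-≤; +-monoʳ-<; +-monoˡ-<; <-≤-trans; <-trans;
         +-suc; suc-injective; n<1+n; n≤0⇒n≡0; +-identityʳ; <-irrefl; +-assoc)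
open import Data.Nat.DivMod using ([m+kn]%n≡m%n)
open import Data.Fin using (Fin; zero; suc; _≟_; toℕ; splitAt; _↑ˡ_; _↑ʳ_)
open import Data.Fin.Properties
  using (splitAt⁻¹-↑ˡ; splitAt⁻¹-↑ʳ; toℕ-↑ˡ; toℕ-↑ʳ; ↑ˡ-injective; toℕ<n; splitAt-↑ˡ; splitAt-↑ʳ)
open import Data.Bool using (Bool; true; false; _∧_; _∨_; not)
open import Data.Bool.Properties
  using (∧-comm; ∧-conicalˡ; ∧-conicalʳ; ∧-identityʳ; ∧-zeroʳ; ∨-identityʳ; ∨-zeroʳ)
open import Data.Vec using ([_])
open import Data.Product using (_×_; _,_; proj₁; proj₂; Σ-syntax)
open import Data.Sum using (_⊎_; inj₁; inj₂; [_,_]′)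
open import Relation.Nullary using (¬_; yes; no)
open import Relation.Binary.PropositionalEquality
  using (_≡_; refl; sym; trans; cong; cong₂; _≢_; ≢-sym; subst)
open import Data.Empty using (⊥-elim)
open import Function using (_∘_)

private
  variable
    m : ℕ

not-true⇒false : ∀ {a} → not a ≡ true → a ≡ false
not-true⇒false {false} _ = refl

∧-intro : ∀ {a b} → a ≡ true → b ≡ true → (a ∧ b) ≡ true
∧-intro refl refl = refl

∨-elim : ∀ {a b} → (a ∨ b) ≡ true → a ≡ true ⊎ b ≡ true
∨-elim {true}  _ = inj₁ refl
∨-elim {false} e = inj₂ e

==-refl : (a : Fin m) → (a == a) ≡ true
==-refl a with a ≟ a
... | yes _ = refl
... | no a≢a = ⊥-elim (a≢a refl)

==-≢ : {a b : Fin m} → a ≢ b → (a == b) ≡ false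
==-≢ {a = a} {b} a≢b with a ≟ b
... | yes a≡b = ⊥-elim (a≢b a≡b)
... | no _ = refl

==-true⇒≡ : {a b : Fin m} → (a == b) ≡ true → a ≡ b
==-true⇒≡ {a = a} {b} e with a ≟ b
... | yes a≡b = a≡b

==-false⇒≢ : {a b : Fin m} → (a == b) ≡ false → a ≢ b
==-false⇒≢ {a = a} e refl with a ≟ a
... | no a≢a = a≢a refl

==-sym : (a b : Fin m) → (a == b) ≡ (b == a)
==-sym a b with a ≟ b | b ≟ a
... | yes _   | yes _   = refl
... | no _    | no _    = refl
... | yes a≡b | no b≢a  = ⊥-elim (b≢a (sym a≡b))
... | no a≢b  | yes b≡a = ⊥-elim (a≢b (sym b≡a))

==-suc : (a b : Fin m) → (suc a == suc b) ≡ (a == b)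
==-suc a b with a ≟ b
... | yes _ = refl
... | no _  = refl

not-==-both : {x y : Fin m} → x ≢ y → ∀ a → not ((a == x) ∧ (a == y)) ≡ true
not-==-both {x = x} x≢y a with a ≟ x
... | yes refl = cong not (==-≢ x≢y)
... | no _     = refl

-- Boolean identities by truth tables

BoolFun : ℕ → Set
BoolFun zero    = Bool
BoolFun (suc n) = Bool → BoolFun n

AgreeUnder : ∀ n → BoolFun n → BoolFun n → BoolFun n → Set
AgreeUnder zero    h a b = h ≡ true → a ≡ b
AgreeUnder (suc n) h f g = ∀ x → AgreeUnder n (h x) (f x) (g x)

Agree : ∀ n → BoolFun n → BoolFun n → Set
Agree zero    a b = a ≡ b
Agree (suc n) f g = ∀ x → Agree n (f x) (g x)

_≡ᵇ_ : Bool → Bool → Bool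
true  ≡ᵇ b = b
false ≡ᵇ b = not b

≡ᵇ-sound : ∀ a b → (a ≡ᵇ b) ≡ true → a ≡ b
≡ᵇ-sound true  true  _ = refl
≡ᵇ-sound false false _ = refl

agree-under? : ∀ n → (h f g : BoolFun n) → Bool
agree-under? zero    h a b = not h ∨ (a ≡ᵇ b)
agree-under? (suc n) h f g = agree-under? n (h true) (f true) (g true) ∧ agree-under? n (h false) (f false) (g false)

agree? : ∀ n → (f g : BoolFun n) → Bool
agree? zero    a b = a ≡ᵇ b
agree? (suc n) f g = agree? n (f true) (g true) ∧ agree? n (f false) (g false)

truth-table-under : ∀ n (h f g : BoolFun n) → agree-under? n h f g ≡ true → AgreeUnder n h f g
truth-table-under zero    true  a b e _ = ≡ᵇ-sound a b e
truth-table-under (suc n) h f g e true  = truth-table-under n (h true) (f true) (g true) (∧-conicalˡ _ _ e)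
truth-table-under (suc n) h f g e false = truth-table-under n (h false) (f false) (g false) (∧-conicalʳ _ _ e)

truth-table : ∀ n (f g : BoolFun n) → agree? n f g ≡ true → Agree n f g
truth-table zero    a b e = ≡ᵇ-sound a b e
truth-table (suc n) f g e true  = truth-table n (f true) (g true) (∧-conicalˡ _ _ e)
truth-table (suc n) f g e false = truth-table n (f false) (g false) (∧-conicalʳ _ _ e)

sumFin : (Fin m → ℕ) → ℕ
sumFin {zero}  f = 0
sumFin {suc m} f = f zero + sumFin (λ a → f (suc a))

b2n : Bool → ℕ
b2n true  = 1
b2n false = 0

count : (Fin m → Bool) → ℕ
count f = sumFin (λ a → b2n (f a))

remove : (Fin m → Bool) → Fin m → Fin m → Bool
remove f u a = f a ∧ not (a == u)

_⊆ᵇ_ : (f g : Fin m → Bool) → Set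
f ⊆ᵇ g = ∀ a → f a ≡ true → g a ≡ true

sumFin-cong : (f g : Fin m → ℕ) → (∀ a → f a ≡ g a) → sumFin f ≡ sumFin g
sumFin-cong {zero}  f g f≗g = refl
sumFin-cong {suc m} f g f≗g =
  cong₂ _+_ (f≗g zero) (sumFin-cong (λ a → f (suc a)) (λ a → g (suc a)) (λ a → f≗g (suc a)))

sumFin-mono : (f g : Fin m → ℕ) → (∀ a → f a ≤ g a) → sumFin f ≤ sumFin g
sumFin-mono {zero}  f g f≤g = z≤n
sumFin-mono {suc m} f g f≤g =
  +-mono-≤ (f≤g zero) (sumFin-mono (λ a → f (suc a)) (λ a → g (suc a)) (λ a → f≤g (suc a)))

sumFin-strict : (f g : Fin m → ℕ) → (∀ a → f a ≤ g a) → (u : Fin m) → f u < g u → sumFin f < sumFin g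
sumFin-strict {suc m} f g f≤g zero fu<gu =
  ≤-trans (+-monoˡ-< _ fu<gu)
          (+-monoʳ-≤ (g zero) (sumFin-mono (λ a → f (suc a)) (λ a → g (suc a)) (λ a → f≤g (suc a))))
sumFin-strict {suc m} f g f≤g (suc u) fu<gu =
  ≤-trans (+-monoʳ-< (f zero) (sumFin-strict (λ a → f (suc a)) (λ a → g (suc a)) (λ a → f≤g (suc a)) u fu<gu))
          (+-monoˡ-≤ _ (f≤g zero))

b2n-mono : ∀ {a b} → (a ≡ true → b ≡ true) → b2n a ≤ b2n b
b2n-mono {false} _ = z≤n
b2n-mono {true}  h rewrite h refl = ≤-refl

count-cong : (f g : Fin m → Bool) → (∀ a → f a ≡ g a) → count f ≡ count g
count-cong f g f≗g = sumFin-cong _ _ (λ a → cong b2n (f≗g a))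

count-mono : (f g : Fin m → Bool) → f ⊆ᵇ g → count f ≤ count g
count-mono f g f⊆g = sumFin-mono _ _ (λ a → b2n-mono (f⊆g a))

count-strict : (f g : Fin m → Bool) → f ⊆ᵇ g → (u : Fin m) → f u ≡ false → g u ≡ true → count f < count g
count-strict f g f⊆g u fu gu = sumFin-strict _ _ (λ a → b2n-mono (f⊆g a)) u b2n[fu]<b2n[gu]
  where
  b2n[fu]<b2n[gu] : b2n (f u) < b2n (g u)
  b2n[fu]<b2n[gu] rewrite fu | gu = s≤s z≤n

remove-true : (f : Fin m → Bool) {a u : Fin m} → f a ≡ true → a ≢ u → remove f u a ≡ true
remove-true f fa a≢u rewrite fa | ==-≢ a≢u = refl

remove-true⁻ : (f : Fin m → Bool) {u a : Fin m} → remove f u a ≡ true → f a ≡ true × a ≢ u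
remove-true⁻ f {a = a} e = ∧-conicalˡ _ _ e , ==-false⇒≢ (not-true⇒false (∧-conicalʳ (f a) _ e))

remove-absent : (f : Fin m → Bool) (u : Fin m) → f u ≡ false → ∀ a → remove f u a ≡ f a
remove-absent f u fu a with a ≟ u
... | yes refl = trans (cong (_∧ _) fu) (sym fu)
... | no _     = ∧-identityʳ _

count-remove : (f : Fin m → Bool) (u : Fin m) → f u ≡ true → count f ≡ suc (count (remove f u))
count-remove {suc m} f zero fu rewrite fu =
  cong suc (count-cong (λ a → f (suc a)) (λ a → f (suc a) ∧ true) (λ a → sym (∧-identityʳ _)))
count-remove {suc m} f (suc u) fu rewrite count-remove (λ a → f (suc a)) u fu | ∧-identityʳ (f zero) =
  trans (+-suc (b2n (f zero)) (count (remove (λ a → f (suc a)) u)))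
    (cong (λ k → suc (b2n (f zero) + k)) (count-cong _ _ (λ a → cong (λ t → f (suc a) ∧ not t) (sym (==-suc a u)))))

count-remove-suc : (f : Fin m → Bool) {u : Fin m} {k : ℕ} → f u ≡ true → count f ≡ suc k → count (remove f u) ≡ k
count-remove-suc f fu eq = suc-injective (trans (sym (count-remove f _ fu)) eq)

count-remove₂ : (f : Fin m → Bool) {a b : Fin m} {k : ℕ} → f a ≡ true → f b ≡ true → a ≢ b →
  count f ≡ suc (suc k) → count (remove (remove f a) b) ≡ k
count-remove₂ f {a} fa fb a≢b eq =
  count-remove-suc (remove f a) (remove-true f fb (≢-sym a≢b)) (count-remove-suc f fa eq)

count-remove₂-absent : (f : Fin m → Bool) {a b : Fin m} → f a ≡ false → f b ≡ false → count (remove (remove f a) b) ≡ count f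
count-remove₂-absent f {a} {b} fa fb =
  count-cong _ _ (λ z → trans (cong (_∧ _) (remove-absent f a fa z)) (remove-absent f b fb z))

count-suc⇒true : (f : Fin m → Bool) {k : ℕ} → count f ≡ suc k → Σ[ a ∈ Fin m ] f a ≡ true
count-suc⇒true {zero}  f ()
count-suc⇒true {suc m} f eq with f zero in fzero
... | true  = zero , fzero
... | false = let (a , fa) = count-suc⇒true (λ a → f (suc a)) eq in suc a , fa

count-suc-suc⇒two : (f : Fin m → Bool) {k : ℕ} → count f ≡ suc (suc k) →
  Σ[ a ∈ Fin m ] Σ[ b ∈ Fin m ] f a ≡ true × f b ≡ true × a ≢ b
count-suc-suc⇒two f eq with count-suc⇒true f eq
... | a , fa with count-suc⇒true (remove f a) (count-remove-suc f fa eq)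
... | b , fb = a , b , fa , ∧-conicalˡ _ _ fb , λ a≡b → ==-false⇒≢ (not-true⇒false (∧-conicalʳ (f b) _ fb)) (sym a≡b)

count-zero⇒false : (f : Fin m → Bool) → count f ≡ 0 → ∀ a → f a ≡ false
count-zero⇒false {suc m} f eq zero with f zero
... | false = refl
count-zero⇒false {suc m} f eq (suc a) with f zero
... | false = count-zero⇒false (λ a → f (suc a)) eq a

count-zero-⊆ : (f g : Fin m → Bool) → g ⊆ᵇ f → count f ≡ 0 → count g ≡ 0
count-zero-⊆ f g g⊆f eq = n≤0⇒n≡0 (subst (count g ≤_) eq (count-mono g f g⊆f))

count-one-unique : (f : Fin m → Bool) {a b : Fin m} → count f ≡ 1 → f a ≡ true → f b ≡ true → a ≡ b
count-one-unique f {a} {b} eq fa fb with a ≟ b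
... | yes a≡b = a≡b
... | no a≢b with trans (sym (remove-true f fb (≢-sym a≢b))) (count-zero⇒false (remove f a) (count-remove-suc f fa eq) b)
...   | ()

count-split : (f h : Fin m → Bool) → count f ≡ count (λ z → f z ∧ h z) + count (λ z → f z ∧ not (h z))
count-split {zero}  f h = refl
count-split {suc m} f h rewrite count-split (λ z → f (suc z)) (λ z → h (suc z)) = split-head (f zero) (h zero)
  where
  split-head : ∀ x y {A B : ℕ} → b2n x + (A + B) ≡ (b2n (x ∧ y) + A) + (b2n (x ∧ not y) + B)
  split-head false y = refl
  split-head true true = refl
  split-head true false {A} {B} = sym (+-suc A B)

count-↑ : ∀ n k (f : Fin (n + k) → Bool) → count f ≡ count (λ p → f (p ↑ˡ k)) + count (λ q → f (n ↑ʳ q))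
count-↑ zero    k f = refl
count-↑ (suc n) k f rewrite count-↑ n k (λ a → f (suc a)) = sym (+-assoc (b2n (f zero)) _ _)

count-true : ∀ n → count {n} (λ _ → true) ≡ n
count-true zero    = refl
count-true (suc n) = cong suc (count-true n)

count-false : ∀ n → count {n} (λ _ → false) ≡ 0
count-false zero    = refl
count-false (suc n) = count-false n

count-<ᵇ : ∀ n i → i ≤ n → count {n} (λ p → toℕ p <ᵇ i) ≡ i
count-<ᵇ n       zero    _         = count-false n
count-<ᵇ (suc n) (suc i) (s≤s i≤n) = cong suc (count-<ᵇ n i i≤n)

size : Graph m → ℕ
size g = count (V g) + sumFin (λ a → count (E g a))

move-size : {g g′ : Graph m} → Move g g′ → size g′ < size g
move-size {g = g} (edgeMove x y exy) =
  +-monoʳ-< (count (V g)) (sumFin-strict _ _ (λ a → count-mono _ _ (row⊆ a)) x (count-strict _ _ (row⊆ x) y gone exy))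
  where
  row⊆ : ∀ a → E (delEdge g x y) a ⊆ᵇ E g a
  row⊆ a b = ∧-conicalˡ _ _
  gone : E (delEdge g x y) x y ≡ false
  gone rewrite ==-refl x | ==-refl y | exy = refl
move-size {g = g} (vertexMove x vx) =
  ≤-trans (+-monoˡ-< _ (count-strict _ _ (λ a → ∧-conicalˡ _ _) x gone vx))
          (+-monoʳ-≤ (count (V g)) (sumFin-mono _ _ (λ a → count-mono _ _ (row⊆ a))))
  where
  row⊆ : ∀ a → E (delVertex g x) a ⊆ᵇ E g a
  row⊆ a b = ∧-conicalˡ _ _
  gone : V (delVertex g x) x ≡ false
  gone rewrite ==-refl x | vx = refl

_≈_ : Graph m → Graph m → Set
g ≈ h = (∀ a → V g a ≡ V h a) × (∀ a b → E g a b ≡ E h a b)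

≈-refl : {g : Graph m} → g ≈ g
≈-refl = (λ _ → refl) , (λ _ _ → refl)

≈-sym : {g h : Graph m} → g ≈ h → h ≈ g
≈-sym (V≗ , E≗) = (λ a → sym (V≗ a)) , (λ a b → sym (E≗ a b))

≈-trans : {g h k : Graph m} → g ≈ h → h ≈ k → g ≈ k
≈-trans (V≗ , E≗) (V≗′ , E≗′) = (λ a → trans (V≗ a) (V≗′ a)) , (λ a b → trans (E≗ a b) (E≗′ a b))

delEdge-cong : {g h : Graph m} (x y : Fin m) → g ≈ h → delEdge g x y ≈ delEdge h x y
delEdge-cong x y (V≗ , E≗) = V≗ , (λ a b → cong (_∧ _) (E≗ a b))

delVertex-cong : {g h : Graph m} (x : Fin m) → g ≈ h → delVertex g x ≈ delVertex h x
delVertex-cong x (V≗ , E≗) = (λ a → cong (_∧ _) (V≗ a)) , (λ a b → cong (_∧ _) (E≗ a b))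

delEdge-comm : (g : Graph m) (a b : Fin m) → delEdge g a b ≈ delEdge g b a
delEdge-comm g a b = (λ _ → refl) , λ c d → cong (E g c d ∧_) (cong not
  (truth-table 4 (λ p q r s → (p ∧ q) ∨ (r ∧ s)) (λ p q r s → (r ∧ s) ∨ (p ∧ q)) refl (c == a) (d == b) (c == b) (d == a)))

mutual
  Win-≈ : {g h : Graph m} → g ≈ h → Win g → Win h
  Win-≈ g≈h (win (edgeMove x y exy) l) =
    win (edgeMove x y (trans (sym (proj₂ g≈h x y)) exy)) (Lose-≈ (delEdge-cong x y g≈h) l)
  Win-≈ g≈h (win (vertexMove x vx) l) =
    win (vertexMove x (trans (sym (proj₁ g≈h x)) vx)) (Lose-≈ (delVertex-cong x g≈h) l)

  Lose-≈ : {g h : Graph m} → g ≈ h → Lose g → Lose h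
  Lose-≈ g≈h (lose f) = lose λ where
    (edgeMove x y exy) → Win-≈ (delEdge-cong x y g≈h) (f (edgeMove x y (trans (proj₂ g≈h x y) exy)))
    (vertexMove x vx)  → Win-≈ (delVertex-cong x g≈h) (f (vertexMove x (trans (proj₁ g≈h x) vx)))

-- Twins

SymmetricEdges : Graph m → Set
SymmetricEdges g = ∀ a b → E g a b ≡ E g b a

delEdge-symmetric : {g : Graph m} (x y : Fin m) → SymmetricEdges g → SymmetricEdges (delEdge g x y)
delEdge-symmetric x y sym-g a b = cong₂ _∧_ (sym-g a b) (cong not
  (truth-table 4 (λ p q r s → (p ∧ q) ∨ (r ∧ s)) (λ p q r s → (s ∧ r) ∨ (q ∧ p)) refl (a == x) (b == y) (a == y) (b == x)))

delVertex-symmetric : {g : Graph m} (x : Fin m) → SymmetricEdges g → SymmetricEdges (delVertex g x)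
delVertex-symmetric x sym-g a b = cong₂ _∧_ (sym-g a b) (∧-comm (not (a == x)) _)

record Twins (g : Graph m) (x y : Fin m) : Set where
  field
    x-present : V g x ≡ true
    y-present : V g y ≡ true
    x≢y       : x ≢ y
    x≁y       : E g x y ≡ false
    same-row  : ∀ z → E g x z ≡ E g y z
    symmetric : SymmetricEdges g
open Twins

delVertices : Graph m → Fin m → Fin m → Graph m
delVertices g x y = delVertex (delVertex g x) y

twins-swap : {g : Graph m} {x y : Fin m} → Twins g x y → Twins g y x
twins-swap t = record
  { x-present = y-present t ; y-present = x-present t ; x≢y = ≢-sym (x≢y t)
  ; x≁y = trans (symmetric t _ _) (x≁y t) ; same-row = λ z → sym (same-row t z) ; symmetric = symmetric t }

twins-x≁x : {g : Graph m} {x y : Fin m} → Twins g x y → E g x x ≡ false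
twins-x≁x {x = x} {y} t = trans (same-row t x) (trans (symmetric t y x) (x≁y t))

delVertices-V⁻ : (g : Graph m) (x y a : Fin m) → V (delVertices g x y) a ≡ true →
  V g a ≡ true × a ≢ x × a ≢ y
delVertices-V⁻ g x y a e =
  ∧-conicalˡ _ _ (∧-conicalˡ _ _ e) ,
  ==-false⇒≢ (not-true⇒false (∧-conicalʳ (V g a) _ (∧-conicalˡ _ _ e))) ,
  ==-false⇒≢ (not-true⇒false (∧-conicalʳ (V (delVertex g x) a) _ e))

delVertices-E⁻ : (g : Graph m) (x y a b : Fin m) → E (delVertices g x y) a b ≡ true →
  E g a b ≡ true × a ≢ x × b ≢ x × a ≢ y × b ≢ y
delVertices-E⁻ g x y a b e =
  ∧-conicalˡ _ _ (∧-conicalˡ _ _ e) ,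
  ==-false⇒≢ (not-true⇒false (∧-conicalˡ _ _ (∧-conicalʳ (E g a b) _ (∧-conicalˡ _ _ e)))) ,
  ==-false⇒≢ (not-true⇒false (∧-conicalʳ (not (a == x)) _ (∧-conicalʳ (E g a b) _ (∧-conicalˡ _ _ e)))) ,
  ==-false⇒≢ (not-true⇒false (∧-conicalˡ _ _ (∧-conicalʳ (E (delVertex g x) a b) _ e))) ,
  ==-false⇒≢ (not-true⇒false (∧-conicalʳ (not (a == y)) _ (∧-conicalʳ (E (delVertex g x) a b) _ e)))

delVertices-V⁺ : (g : Graph m) (x y a : Fin m) → V g a ≡ true → a ≢ x → a ≢ y → V (delVertices g x y) a ≡ true
delVertices-V⁺ g x y a va a≢x a≢y rewrite va | ==-≢ a≢x | ==-≢ a≢y = refl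

delVertices-E⁺ : (g : Graph m) (x y a b : Fin m) → E g a b ≡ true →
  a ≢ x → b ≢ x → a ≢ y → b ≢ y → E (delVertices g x y) a b ≡ true
delVertices-E⁺ g x y a b eab a≢x b≢x a≢y b≢y rewrite eab | ==-≢ a≢x | ==-≢ b≢x | ==-≢ a≢y | ==-≢ b≢y = refl

delVertices-swap : (g : Graph m) (x y : Fin m) → delVertices g x y ≈ delVertices g y x
delVertices-swap g x y =
  (λ c → truth-table 3 (λ v p q → (v ∧ p) ∧ q) (λ v p q → (v ∧ q) ∧ p) refl (V g c) _ _) ,
  (λ c d → truth-table 3 (λ v p q → (v ∧ p) ∧ q) (λ v p q → (v ∧ q) ∧ p) refl (E g c d) _ _)

∧-rotate : ∀ e p q r → (((e ∧ p) ∧ q) ∧ r) ≡ (((e ∧ q) ∧ r) ∧ p)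
∧-rotate = truth-table 4 (λ e p q r → ((e ∧ p) ∧ q) ∧ r) (λ e p q r → ((e ∧ q) ∧ r) ∧ p) refl

delVertices-delEdge : (g : Graph m) (x y a b : Fin m) → delVertices (delEdge g a b) x y ≈ delEdge (delVertices g x y) a b
delVertices-delEdge g x y a b = (λ _ → refl) , (λ c d → ∧-rotate (E g c d) _ _ _)

delVertices-delVertex : (g : Graph m) (x y a : Fin m) → delVertices (delVertex g a) x y ≈ delVertex (delVertices g x y) a
delVertices-delVertex g x y a = (λ c → ∧-rotate (V g c) _ _ _) , (λ c d → ∧-rotate (E g c d) _ _ _)

twins-delEdge : {g : Graph m} {x y a b : Fin m} → Twins g x y → x ≢ a → x ≢ b → y ≢ a → y ≢ b →
  Twins (delEdge g a b) x y
twins-delEdge {g = g} {x} {y} {a} {b} t x≢a x≢b y≢a y≢b = record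
  { x-present = x-present t ; y-present = y-present t ; x≢y = x≢y t
  ; x≁y = trans (untouched x≢a x≢b y) (x≁y t)
  ; same-row = λ z → trans (untouched x≢a x≢b z) (trans (same-row t z) (sym (untouched y≢a y≢b z)))
  ; symmetric = delEdge-symmetric {g = g} a b (symmetric t) }
  where
  untouched : ∀ {u} → u ≢ a → u ≢ b → ∀ z → E (delEdge g a b) u z ≡ E g u z
  untouched u≢a u≢b z rewrite ==-≢ u≢a | ==-≢ u≢b = ∧-identityʳ _

twins-delVertex : {g : Graph m} {x y a : Fin m} → Twins g x y → x ≢ a → y ≢ a → Twins (delVertex g a) x y
twins-delVertex {g = g} {x} {y} {a} t x≢a y≢a = record
  { x-present = remove-true (V g) (x-present t) x≢a ; y-present = remove-true (V g) (y-present t) y≢a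
  ; x≢y = x≢y t
  ; x≁y = trans (row x≢a y) (cong (_∧ _) (x≁y t))
  ; same-row = λ z → trans (row x≢a z) (trans (cong (_∧ _) (same-row t z)) (sym (row y≢a z)))
  ; symmetric = delVertex-symmetric {g = g} a (symmetric t) }
  where
  row : ∀ {u} → u ≢ a → ∀ z → E (delVertex g a) u z ≡ (E g u z ∧ not (z == a))
  row u≢a z rewrite ==-≢ u≢a = refl

avoid-delEdge : {g c : Graph m} {x y a b : Fin m} → Twins g x y → c ≈ delVertices g x y →
  a ≢ x → b ≢ x → a ≢ y → b ≢ y → Twins (delEdge g a b) x y × delEdge c a b ≈ delVertices (delEdge g a b) x y
avoid-delEdge {g = g} {x = x} {y} {a} {b} t c≈ a≢x b≢x a≢y b≢y =
  twins-delEdge t (≢-sym a≢x) (≢-sym b≢x) (≢-sym a≢y) (≢-sym b≢y) ,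
  ≈-trans (delEdge-cong a b c≈) (≈-sym (delVertices-delEdge g x y a b))

avoid-delVertex : {g c : Graph m} {x y a : Fin m} → Twins g x y → c ≈ delVertices g x y →
  a ≢ x → a ≢ y → Twins (delVertex g a) x y × delVertex c a ≈ delVertices (delVertex g a) x y
avoid-delVertex {g = g} {x = x} {y} {a} t c≈ a≢x a≢y =
  twins-delVertex t (≢-sym a≢x) (≢-sym a≢y) ,
  ≈-trans (delVertex-cong a c≈) (≈-sym (delVertices-delVertex g x y a))

module _ {g : Graph m} {x y z : Fin m} (t : Twins g x y) (exz : E g x z ≡ true) where

  private
    x≢z : x ≢ z
    x≢z refl with trans (sym exz) (twins-x≁x t)
    ... | ()

    y≢z : y ≢ z
    y≢z refl with trans (sym exz) (x≁y t)
    ... | ()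

  mirror-legal : E (delEdge g x z) y z ≡ true
  mirror-legal rewrite ==-≢ (≢-sym (x≢y t)) | ==-≢ y≢z | sym (same-row t z) | exz = refl

  twins-mirror : Twins (delEdge (delEdge g x z) y z) x y
  twins-mirror = record
    { x-present = x-present t ; y-present = y-present t ; x≢y = x≢y t
    ; x≁y = x≁y′ ; same-row = same-row′
    ; symmetric = delEdge-symmetric {g = delEdge g x z} y z (delEdge-symmetric {g = g} x z (symmetric t)) }
    where
    x≁y′ : E (delEdge (delEdge g x z) y z) x y ≡ false
    x≁y′ rewrite x≁y t = refl
    same-row′ : ∀ w → E (delEdge (delEdge g x z) y z) x w ≡ E (delEdge (delEdge g x z) y z) y w
    same-row′ w rewrite ==-refl x | ==-refl y | ==-≢ (x≢y t) | ==-≢ (≢-sym (x≢y t)) | ==-≢ x≢z | ==-≢ y≢z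
                      | same-row t w with E g y w | w == z
    ... | true  | true  = refl
    ... | true  | false = refl
    ... | false | _     = refl

  delVertices-mirror : delVertices (delEdge (delEdge g x z) y z) x y ≈ delVertices g x y
  delVertices-mirror = (λ _ → refl) , λ c d → truth-table 7
    (λ e cx dx cy dy cz dz → (((e ∧ not ((cx ∧ dz) ∨ (cz ∧ dx))) ∧ not ((cy ∧ dz) ∨ (cz ∧ dy))) ∧ not cx ∧ not dx) ∧ not cy ∧ not dy)
    (λ e cx dx cy dy cz dz → (e ∧ not cx ∧ not dx) ∧ not cy ∧ not dy) refl
    (E g c d) (c == x) (d == x) (c == y) (d == y) (c == z) (d == z)

move-size-bound : ∀ {k} {g g′ : Graph m} → size g < suc k → Move g g′ → size g′ < k
move-size-bound sz mv = <-≤-trans (move-size mv) (s≤s⁻¹ sz)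

mutual
  mirror-win : ∀ k {g c : Graph m} {x y : Fin m} → size g < k → Twins g x y → c ≈ delVertices g x y → Win c → Win g
  mirror-win (suc k) {g} {x = x} {y} sz t c≈ (win (edgeMove a b e) l)
    with delVertices-E⁻ g x y a b (trans (sym (proj₂ c≈ a b)) e)
  ... | eab , a≢x , b≢x , a≢y , b≢y =
    let (t′ , c≈′) = avoid-delEdge t c≈ a≢x b≢x a≢y b≢y
    in win (edgeMove a b eab) (mirror-lose k (move-size-bound sz (edgeMove a b eab)) t′ c≈′ l)
  mirror-win (suc k) {g} {x = x} {y} sz t c≈ (win (vertexMove a v) l)
    with delVertices-V⁻ g x y a (trans (sym (proj₁ c≈ a)) v)
  ... | va , a≢x , a≢y =
    let (t′ , c≈′) = avoid-delVertex t c≈ a≢x a≢y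
    in win (vertexMove a va) (mirror-lose k (move-size-bound sz (vertexMove a va)) t′ c≈′ l)

  mirror-lose : ∀ k {g c : Graph m} {x y : Fin m} → size g < k → Twins g x y → c ≈ delVertices g x y → Lose c → Lose g
  mirror-lose (suc k) {g} {c} {x} {y} sz t c≈ (lose c-loses) = lose respond
    where
    c≈′ : c ≈ delVertices g y x
    c≈′ = ≈-trans c≈ (delVertices-swap g x y)

    mirror : ∀ {p q z} → Twins g p q → c ≈ delVertices g p q → (epz : E g p z ≡ true) → Win (delEdge g p z)
    mirror {p} {q} {z} tpq c≈pq epz =
      win (edgeMove q z (mirror-legal tpq epz))
        (mirror-lose k (<-trans (move-size (edgeMove q z (mirror-legal tpq epz))) (move-size-bound sz (edgeMove p z epz)))
          (twins-mirror tpq epz) (≈-trans c≈pq (≈-sym (delVertices-mirror tpq epz))) (lose c-loses))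

    respond : ∀ {g′} → Move g g′ → Win g′
    respond (edgeMove a b e) with a ≟ x | a ≟ y | b ≟ x | b ≟ y
    ... | yes refl | _ | _ | _ = mirror t c≈ e
    ... | no _ | yes refl | _ | _ = mirror (twins-swap t) c≈′ e
    ... | no _ | no _ | yes refl | _ = Win-≈ (delEdge-comm g x a) (mirror t c≈ (trans (symmetric t x a) e))
    ... | no _ | no _ | no _ | yes refl = Win-≈ (delEdge-comm g y a) (mirror (twins-swap t) c≈′ (trans (symmetric t y a) e))
    ... | no a≢x | no a≢y | no b≢x | no b≢y =
      let (t′ , c≈″) = avoid-delEdge t c≈ a≢x b≢x a≢y b≢y
      in mirror-win k (move-size-bound sz (edgeMove a b e)) t′ c≈″
           (c-loses (edgeMove a b (trans (proj₂ c≈ a b) (delVertices-E⁺ g x y a b e a≢x b≢x a≢y b≢y))))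
    respond (vertexMove a v) with a ≟ x | a ≟ y
    ... | yes refl | _ =
      win (vertexMove y (remove-true (V g) (y-present t) (≢-sym (x≢y t)))) (Lose-≈ c≈ (lose c-loses))
    ... | no _ | yes refl =
      win (vertexMove x (remove-true (V g) (x-present t) (x≢y t))) (Lose-≈ c≈′ (lose c-loses))
    ... | no a≢x | no a≢y =
      let (t′ , c≈″) = avoid-delVertex t c≈ a≢x a≢y
      in mirror-win k (move-size-bound sz (vertexMove a v)) t′ c≈″
           (c-loses (vertexMove a (trans (proj₁ c≈ a) (delVertices-V⁺ g x y a v a≢x a≢y))))

twins-win : {g : Graph m} {x y : Fin m} → Twins g x y → Win (delVertices g x y) → Win g
twins-win {g = g} t = mirror-win (suc (size g)) (n<1+n _) t ≈-refl

twins-lose : {g : Graph m} {x y : Fin m} → Twins g x y → Lose (delVertices g x y) → Lose g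
twins-lose {g = g} t = mirror-lose (suc (size g)) (n<1+n _) t ≈-refl

data Mod3 : ℕ → Set where
  3t   : ∀ t → Mod3 (t * 3)
  3t+1 : ∀ t → Mod3 (suc (t * 3))
  3t+2 : ∀ t → Mod3 (suc (suc (t * 3)))

mod3 : ∀ n → Mod3 n
mod3 zero = 3t 0
mod3 (suc n) with mod3 n
... | 3t t   = 3t+1 t
... | 3t+1 t = 3t+2 t
... | 3t+2 t = 3t (suc t)

+-*3-%3 : ∀ r t → (r + t * 3) % 3 ≡ r % 3
+-*3-%3 r t = [m+kn]%n≡m%n r t 3

-- Cliques

record Clique (c : ℕ) (g : Graph m) : Set where
  field
    order     : count (V g) ≡ c
    adjacency : ∀ a b → E g a b ≡ (V g a ∧ V g b ∧ not (a == b))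

record CliqueMinusEdge (c : ℕ) (g : Graph m) (a b : Fin m) : Set where
  field
    a-present : V g a ≡ true
    b-present : V g b ≡ true
    a≢b       : a ≢ b
    order     : count (V g) ≡ suc (suc c)
    adjacency : ∀ p q → E g p q ≡ ((V g p ∧ V g q ∧ not (p == q)) ∧ not ((p == a ∧ q == b) ∨ (p == b ∧ q == a)))

module _ {c : ℕ} {g : Graph m} {a b : Fin m} (cme : CliqueMinusEdge c g a b) where
  open CliqueMinusEdge cme

  cliqueMinusEdge-twins : Twins g a b
  cliqueMinusEdge-twins = record
    { x-present = a-present ; y-present = b-present ; x≢y = a≢b
    ; x≁y = a≁b ; same-row = same-row′ ; symmetric = symmetric′ }
    where
    a≁b : E g a b ≡ false
    a≁b rewrite adjacency a b | ==-refl a | ==-refl b = ∧-zeroʳ _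
    same-row′ : ∀ z → E g a z ≡ E g b z
    same-row′ z rewrite adjacency a z | adjacency b z | a-present | b-present | ==-refl a | ==-refl b
                      | ==-≢ a≢b | ==-≢ (≢-sym a≢b) | ==-sym a z | ==-sym b z =
      truth-table 3 (λ v za zb → (v ∧ not za) ∧ not (zb ∨ false)) (λ v za zb → (v ∧ not zb) ∧ not (false ∨ za)) refl
        (V g z) (z == a) (z == b)
    symmetric′ : SymmetricEdges g
    symmetric′ p q rewrite adjacency p q | adjacency q p | ==-sym q p =
      truth-table 7 (λ vp vq pq pa qb pb qa → (vp ∧ vq ∧ not pq) ∧ not ((pa ∧ qb) ∨ (pb ∧ qa)))
                    (λ vp vq pq pa qb pb qa → (vq ∧ vp ∧ not pq) ∧ not ((qa ∧ pb) ∨ (qb ∧ pa))) refl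
                    (V g p) (V g q) (p == q) (p == a) (q == b) (p == b) (q == a)

  cliqueMinusEdge-delVertices : Clique c (delVertices g a b)
  cliqueMinusEdge-delVertices = record
    { order = count-remove₂ (V g) a-present b-present a≢b order
    ; adjacency = λ p q → trans (cong (λ e → (e ∧ _) ∧ _) (adjacency p q)) (truth-table 7
        (λ vp vq pq pa qb pb qa → (((vp ∧ vq ∧ not pq) ∧ not ((pa ∧ qb) ∨ (pb ∧ qa))) ∧ not pa ∧ not qa) ∧ not pb ∧ not qb)
        (λ vp vq pq pa qb pb qa → ((vp ∧ not pa) ∧ not pb) ∧ ((vq ∧ not qa) ∧ not qb) ∧ not pq) refl
        (V g p) (V g q) (p == q) (p == a) (q == b) (p == b) (q == a)) }

module _ {c : ℕ} {g : Graph m} (cl : Clique c g) where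
  open Clique cl

  clique-present : ∀ {a b} → E g a b ≡ true → V g a ≡ true
  clique-present {a} {b} eab = ∧-conicalˡ _ _ (trans (sym (adjacency a b)) eab)

  clique-empty-lose : c ≡ 0 → Lose g
  clique-empty-lose refl = lose respond
    where
    respond : ∀ {g′} → Move g g′ → Win g′
    respond (vertexMove u vu) with trans (sym vu) (count-zero⇒false (V g) order u)
    ... | ()
    respond (edgeMove a b eab) with trans (sym (clique-present eab)) (count-zero⇒false (V g) order a)
    ... | ()

  clique-delVertex : ∀ {c′ u} → c ≡ suc c′ → V g u ≡ true → Clique c′ (delVertex g u)
  clique-delVertex {u = u} refl vu = record
    { order = count-remove-suc (V g) vu order
    ; adjacency = λ p q → trans (cong (_∧ _) (adjacency p q)) (truth-table 5
        (λ vp vq pq pu qu → (vp ∧ vq ∧ not pq) ∧ not pu ∧ not qu)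
        (λ vp vq pq pu qu → (vp ∧ not pu) ∧ (vq ∧ not qu) ∧ not pq) refl
        (V g p) (V g q) (p == q) (p == u) (q == u)) }

  clique-delEdge : ∀ {c′ a b} → c ≡ suc (suc c′) → E g a b ≡ true → CliqueMinusEdge c′ (delEdge g a b) a b
  clique-delEdge {a = a} {b} refl eab = record
    { a-present = ∧-conicalˡ _ _ adj ; b-present = ∧-conicalˡ _ _ (∧-conicalʳ (V g a) _ adj)
    ; a≢b = ==-false⇒≢ (not-true⇒false (∧-conicalʳ (V g b) _ (∧-conicalʳ (V g a) _ adj)))
    ; order = order ; adjacency = λ p q → cong (_∧ _) (adjacency p q) }
    where
    adj : (V g a ∧ V g b ∧ not (a == b)) ≡ true
    adj = trans (sym (adjacency a b)) eab

  clique-edge : ∀ {a b} → V g a ≡ true → V g b ≡ true → a ≢ b → E g a b ≡ true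
  clique-edge {a} {b} va vb a≢b rewrite adjacency a b | va | vb | ==-≢ a≢b = refl

mutual
  clique-3t-lose : ∀ t {g : Graph m} → Clique (t * 3) g → Lose g
  clique-3t-lose zero cl = clique-empty-lose cl refl
  clique-3t-lose (suc t) cl = lose λ where
    (vertexMove u vu)  → clique-3t+2-win t (clique-delVertex cl refl vu)
    (edgeMove a b eab) →
      let cme = clique-delEdge cl refl eab
      in twins-win (cliqueMinusEdge-twins cme) (clique-3t+1-win t (cliqueMinusEdge-delVertices cme))

  clique-3t+1-win : ∀ t {g : Graph m} → Clique (suc (t * 3)) g → Win g
  clique-3t+1-win t {g} cl with count-suc⇒true (V g) (Clique.order cl)
  ... | u , vu = win (vertexMove u vu) (clique-3t-lose t (clique-delVertex cl refl vu))

  clique-3t+2-win : ∀ t {g : Graph m} → Clique (suc (suc (t * 3))) g → Win g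
  clique-3t+2-win t {g} cl with count-suc-suc⇒two (V g) (Clique.order cl)
  ... | a , b , va , vb , a≢b =
    let eab = clique-edge cl va vb a≢b
        cme = clique-delEdge cl refl eab
    in win (edgeMove a b eab) (twins-lose (cliqueMinusEdge-twins cme) (clique-3t-lose t (cliqueMinusEdge-delVertices cme)))

-- Stars

record Star (c i : ℕ) (g : Graph m) (w : Fin m) (N : Fin m → Bool) : Set where
  field
    hub-present  : V g w ≡ true
    clique-order : count (remove (V g) w) ≡ c
    spoke-count  : count N ≡ i
    spokes⊆      : N ⊆ᵇ remove (V g) w
    adjacency    : ∀ a b → E g a b ≡
      ((remove (V g) w a ∧ remove (V g) w b ∧ not (a == b)) ∨ (a == w ∧ N b) ∨ (b == w ∧ N a))

module _ {c i : ℕ} {g : Graph m} {w : Fin m} {N : Fin m → Bool} (st : Star c i g w N) where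
  open Star st

  star-delHub : Clique c (delVertex g w)
  star-delHub = record { order = clique-order ; adjacency = λ a b → trans (cong (_∧ _) (adjacency a b)) (truth-table 7
    (λ va vb aw bw ab na nb → (((va ∧ not aw) ∧ (vb ∧ not bw) ∧ not ab) ∨ (aw ∧ nb) ∨ (bw ∧ na)) ∧ not aw ∧ not bw)
    (λ va vb aw bw ab na nb → ((va ∧ not aw) ∧ (vb ∧ not bw) ∧ not ab)) refl
    (V g a) (V g b) (a == w) (b == w) (a == b) (N a) (N b)) }

  star-symmetric : SymmetricEdges g
  star-symmetric a b rewrite adjacency a b | adjacency b a | ==-sym b a = truth-table 7
    (λ va vb aw bw ab na nb → ((va ∧ not aw) ∧ (vb ∧ not bw) ∧ not ab) ∨ (aw ∧ nb) ∨ (bw ∧ na))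
    (λ va vb aw bw ab na nb → ((vb ∧ not bw) ∧ (va ∧ not aw) ∧ not ab) ∨ (bw ∧ na) ∨ (aw ∧ nb))
    refl (V g a) (V g b) (a == w) (b == w) (a == b) (N a) (N b)

  star-spoke-edge : ∀ {p} → N p ≡ true → E g w p ≡ true
  star-spoke-edge {p} np rewrite adjacency w p | ==-refl w | np = ∨-zeroʳ _

  star-clique-edge : ∀ {a b} → remove (V g) w a ≡ true → remove (V g) w b ≡ true → a ≢ b → E g a b ≡ true
  star-clique-edge {a} {b} ca cb a≢b rewrite adjacency a b | ca | cb | ==-≢ a≢b = refl

  star-edge-cases : ∀ {a b} → E g a b ≡ true →
    (a ≡ w × N b ≡ true) ⊎ (b ≡ w × N a ≡ true) ⊎
    (remove (V g) w a ≡ true × remove (V g) w b ≡ true × a ≢ b)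
  star-edge-cases {a} {b} eab with ∨-elim (trans (sym (adjacency a b)) eab)
  ... | inj₁ in-clique =
    let cb∧a≢b = ∧-conicalʳ (remove (V g) w a) _ in-clique
    in inj₂ (inj₂ (∧-conicalˡ _ _ in-clique , ∧-conicalˡ _ _ cb∧a≢b ,
                   ==-false⇒≢ (not-true⇒false (∧-conicalʳ (remove (V g) w b) _ cb∧a≢b))))
  ... | inj₂ spoke with ∨-elim spoke
  ...   | inj₁ a-hub = inj₁ (==-true⇒≡ (∧-conicalˡ _ _ a-hub) , ∧-conicalʳ (a == w) _ a-hub)
  ...   | inj₂ b-hub = inj₂ (inj₁ (==-true⇒≡ (∧-conicalˡ _ _ b-hub) , ∧-conicalʳ (b == w) _ b-hub))

  star-delVertex : ∀ {c′ i′ u} → c ≡ suc c′ → V g u ≡ true → u ≢ w → count (remove N u) ≡ i′ →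
    Star c′ i′ (delVertex g u) w (remove N u)
  star-delVertex {u = u} refl vu u≢w #N′ = record
    { hub-present = remove-true (V g) hub-present (≢-sym u≢w)
    ; clique-order = trans (count-cong _ _ (λ a → truth-table 3 (λ v p q → (v ∧ p) ∧ q) (λ v p q → (v ∧ q) ∧ p) refl (V g a) _ _))
                           (count-remove-suc (remove (V g) w) (remove-true (V g) vu u≢w) clique-order)
    ; spoke-count = #N′
    ; spokes⊆ = spokes⊆′
    ; adjacency = λ a b → trans (cong (_∧ _) (adjacency a b)) (truth-table-under 9
        (λ va vb aw bw ab na nb au bu → not (aw ∧ au) ∧ not (bw ∧ bu))
        (λ va vb aw bw ab na nb au bu → (((va ∧ not aw) ∧ (vb ∧ not bw) ∧ not ab) ∨ (aw ∧ nb) ∨ (bw ∧ na)) ∧ not au ∧ not bu)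
        (λ va vb aw bw ab na nb au bu → (((va ∧ not au) ∧ not aw) ∧ ((vb ∧ not bu) ∧ not bw) ∧ not ab)
                                         ∨ (aw ∧ (nb ∧ not bu)) ∨ (bw ∧ (na ∧ not au)))
        refl (V g a) (V g b) (a == w) (b == w) (a == b) (N a) (N b) (a == u) (b == u)
        (∧-intro (not-==-both (≢-sym u≢w) a) (not-==-both (≢-sym u≢w) b))) }
    where
    spokes⊆′ : remove N u ⊆ᵇ remove (V (delVertex g u)) w
    spokes⊆′ a e with remove-true⁻ N e
    ... | na , a≢u with remove-true⁻ (V g) (spokes⊆ a na)
    ...   | va , a≢w rewrite va | ==-≢ a≢u | ==-≢ a≢w = refl

  star-delSpoke : ∀ {i′ p} → i ≡ suc i′ → N p ≡ true → Star c i′ (delEdge g w p) w (remove N p)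
  star-delSpoke {p = p} refl np = record
    { hub-present = hub-present ; clique-order = clique-order
    ; spoke-count = count-remove-suc N np spoke-count
    ; spokes⊆ = λ a e → spokes⊆ a (∧-conicalˡ _ _ e)
    ; adjacency = λ a b → trans (cong (_∧ _) (adjacency a b)) (truth-table-under 9
        (λ va vb aw bw ab na nb ap bp → not (aw ∧ ap) ∧ not (bw ∧ bp))
        (λ va vb aw bw ab na nb ap bp → (((va ∧ not aw) ∧ (vb ∧ not bw) ∧ not ab) ∨ (aw ∧ nb) ∨ (bw ∧ na))
                                         ∧ not ((aw ∧ bp) ∨ (ap ∧ bw)))
        (λ va vb aw bw ab na nb ap bp → ((va ∧ not aw) ∧ (vb ∧ not bw) ∧ not ab) ∨ (aw ∧ (nb ∧ not bp)) ∨ (bw ∧ (na ∧ not ap)))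
        refl (V g a) (V g b) (a == w) (b == w) (a == b) (N a) (N b) (a == p) (b == p)
        (∧-intro (not-==-both w≢p a) (not-==-both w≢p b))) }
    where
    w≢p : w ≢ p
    w≢p = ≢-sym (proj₂ (remove-true⁻ (V g) (spokes⊆ p np)))

  module _ {a b : Fin m} (ca : remove (V g) w a ≡ true) (cb : remove (V g) w b ≡ true) (a≢b : a ≢ b) where
    private
      a≢w : a ≢ w
      a≢w = proj₂ (remove-true⁻ (V g) ca)
      b≢w : b ≢ w
      b≢w = proj₂ (remove-true⁻ (V g) cb)

    star-twins : N a ≡ N b → Twins (delEdge g a b) a b
    star-twins na≡nb = record
      { x-present = proj₁ (remove-true⁻ (V g) ca) ; y-present = proj₁ (remove-true⁻ (V g) cb) ; x≢y = a≢b
      ; x≁y = a≁b ; same-row = same-row′ ; symmetric = delEdge-symmetric {g = g} a b star-symmetric }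
      where
      a≁b : E (delEdge g a b) a b ≡ false
      a≁b rewrite ==-refl a | ==-refl b = ∧-zeroʳ _
      same-row′ : ∀ z → E (delEdge g a b) a z ≡ E (delEdge g a b) b z
      same-row′ z rewrite adjacency a z | adjacency b z | ==-refl a | ==-refl b | ==-≢ a≢b | ==-≢ (≢-sym a≢b)
                        | ==-sym a z | ==-sym b z | ca | cb | ==-≢ a≢w | ==-≢ b≢w | na≡nb = truth-table-under 5
        (λ vz zw za zb nb → not (zw ∧ za) ∧ not (zw ∧ zb))
        (λ vz zw za zb nb → (((vz ∧ not zw) ∧ not za) ∨ (zw ∧ nb)) ∧ not (zb ∨ false))
        (λ vz zw za zb nb → (((vz ∧ not zw) ∧ not zb) ∨ (zw ∧ nb)) ∧ not za)
        refl (V g z) (z == w) (z == a) (z == b) (N b)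
        (∧-intro (not-==-both (≢-sym a≢w) z) (not-==-both (≢-sym b≢w) z))

    star-delVertices : ∀ {c′ i′} → c ≡ suc (suc c′) → count (remove (remove N a) b) ≡ i′ →
      Star c′ i′ (delVertices (delEdge g a b) a b) w (remove (remove N a) b)
    star-delVertices refl #N′ = record
      { hub-present = hub-present′
      ; clique-order = trans (count-cong _ _ (λ z → truth-table 4 (λ v p q r → ((v ∧ p) ∧ q) ∧ r) (λ v p q r → ((v ∧ r) ∧ p) ∧ q)
                               refl (V g z) _ _ _))
                             (count-remove₂ (remove (V g) w) ca cb a≢b clique-order)
      ; spoke-count = #N′
      ; spokes⊆ = spokes⊆′
      ; adjacency = λ p q → trans (cong (λ e → ((e ∧ _) ∧ _) ∧ _) (adjacency p q)) (truth-table-under 11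
          (λ vp vq pw qw pq np nq pa qa pb qb → (not (pw ∧ pa) ∧ not (pw ∧ pb)) ∧ (not (qw ∧ qa) ∧ not (qw ∧ qb)))
          (λ vp vq pw qw pq np nq pa qa pb qb →
             (((((vp ∧ not pw) ∧ (vq ∧ not qw) ∧ not pq) ∨ (pw ∧ nq) ∨ (qw ∧ np)) ∧ not ((pa ∧ qb) ∨ (pb ∧ qa)))
               ∧ not pa ∧ not qa) ∧ not pb ∧ not qb)
          (λ vp vq pw qw pq np nq pa qa pb qb →
             ((((vp ∧ not pa) ∧ not pb) ∧ not pw) ∧ (((vq ∧ not qa) ∧ not qb) ∧ not qw) ∧ not pq)
               ∨ (pw ∧ ((nq ∧ not qa) ∧ not qb)) ∨ (qw ∧ ((np ∧ not pa) ∧ not pb)))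
          refl (V g p) (V g q) (p == w) (q == w) (p == q) (N p) (N q) (p == a) (q == a) (p == b) (q == b)
          (∧-intro (∧-intro (not-==-both (≢-sym a≢w) p) (not-==-both (≢-sym b≢w) p))
                   (∧-intro (not-==-both (≢-sym a≢w) q) (not-==-both (≢-sym b≢w) q)))) }
      where
      hub-present′ : V (delVertices (delEdge g a b) a b) w ≡ true
      hub-present′ rewrite hub-present | ==-≢ (≢-sym a≢w) | ==-≢ (≢-sym b≢w) = refl
      spokes⊆′ : remove (remove N a) b ⊆ᵇ remove (V (delVertices (delEdge g a b) a b)) w
      spokes⊆′ z e with remove-true⁻ (remove N a) e
      ... | nz′ , z≢b with remove-true⁻ N nz′
      ...   | nz , z≢a with remove-true⁻ (V g) (spokes⊆ z nz)
      ...     | vz , z≢w rewrite vz | ==-≢ z≢a | ==-≢ z≢b | ==-≢ z≢w = refl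

    star-delEdge-delHub : ∀ {c′} → c ≡ suc (suc c′) → CliqueMinusEdge c′ (delVertex (delEdge g a b) w) a b
    star-delEdge-delHub refl = record
      { a-present = ca ; b-present = cb ; a≢b = a≢b ; order = clique-order
      ; adjacency = λ p q → trans (cong (λ e → (e ∧ _) ∧ _) (adjacency p q)) (truth-table 11
          (λ vp vq pw qw pq np nq pa qa pb qb →
             ((((vp ∧ not pw) ∧ (vq ∧ not qw) ∧ not pq) ∨ (pw ∧ nq) ∨ (qw ∧ np)) ∧ not ((pa ∧ qb) ∨ (pb ∧ qa))) ∧ not pw ∧ not qw)
          (λ vp vq pw qw pq np nq pa qa pb qb → ((vp ∧ not pw) ∧ (vq ∧ not qw) ∧ not pq) ∧ not ((pa ∧ qb) ∨ (pb ∧ qa)))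
          refl (V g p) (V g q) (p == w) (q == w) (p == q) (N p) (N q) (p == a) (q == a) (p == b) (q == b)) }

  star-non-spokes : i + count (λ z → remove (V g) w z ∧ not (N z)) ≡ c
  star-non-spokes = trans (cong (_+ _) (sym (trans (count-cong _ _ spoke∈clique) spoke-count)))
                          (trans (sym (count-split (remove (V g) w) N)) clique-order)
    where
    spoke∈clique : ∀ z → (remove (V g) w z ∧ N z) ≡ N z
    spoke∈clique z with N z in nz
    ... | true  = cong (_∧ true) (spokes⊆ z nz)
    ... | false = ∧-zeroʳ _

star-3t-win : ∀ t {i} {g : Graph m} {w N} → Star (t * 3) i g w N → Win g
star-3t-win t st = win (vertexMove _ (Star.hub-present st)) (clique-3t-lose t (star-delHub st))

mutual
  star₀-3t+1-lose : ∀ t {g : Graph m} {w N} → Star (suc (t * 3)) 0 g w N → Lose g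
  star₀-3t+1-lose t {g} {w} {N} st = lose respond
    where
    open Star st
    no-spoke : ∀ z → N z ≡ false
    no-spoke = count-zero⇒false N spoke-count

    respond : ∀ {g′} → Move g g′ → Win g′
    respond (vertexMove u vu) with u ≟ w
    ... | yes refl = clique-3t+1-win t (star-delHub st)
    ... | no u≢w   = star-3t-win t (star-delVertex st refl vu u≢w (count-zero-⊆ N _ (λ z → ∧-conicalˡ _ _) spoke-count))
    respond (edgeMove a b eab) with star-edge-cases st eab
    ... | inj₁ (_ , nb) with trans (sym nb) (no-spoke b)
    ...   | ()
    respond (edgeMove a b eab) | inj₂ (inj₁ (_ , na)) with trans (sym na) (no-spoke a)
    ...   | ()
    respond (edgeMove a b eab) | inj₂ (inj₂ (ca , cb , a≢b)) =
      star₀-clique-edge t st ca cb a≢b (trans (no-spoke a) (sym (no-spoke b)))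

  star₀-clique-edge : ∀ t {g : Graph m} {w N a b} → Star (suc (t * 3)) 0 g w N →
    remove (V g) w a ≡ true → remove (V g) w b ≡ true → a ≢ b → N a ≡ N b → Win (delEdge g a b)
  star₀-clique-edge zero    {g} {w} st ca cb a≢b _ = ⊥-elim (a≢b (count-one-unique (remove (V g) w) (Star.clique-order st) ca cb))
  star₀-clique-edge (suc t) {N = N} st ca cb a≢b na≡nb =
    twins-win (star-twins st ca cb a≢b na≡nb)
      (star₀-3t+2-win t (star-delVertices st ca cb a≢b refl
        (count-zero-⊆ N _ (λ z → ∧-conicalˡ _ _ ∘ ∧-conicalˡ _ _) (Star.spoke-count st))))

  star₀-3t+2-win : ∀ t {g : Graph m} {w N} → Star (suc (suc (t * 3))) 0 g w N → Win g
  star₀-3t+2-win t {g} {N = N} st with count-suc⇒true _ (Star.clique-order st)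
  ... | u , cu =
    let (vu , u≢w) = remove-true⁻ (V g) cu
    in win (vertexMove u vu)
           (star₀-3t+1-lose t (star-delVertex st refl vu u≢w (count-zero-⊆ N _ (λ z → ∧-conicalˡ _ _) (Star.spoke-count st))))

star₁-win : ∀ c {g : Graph m} {w N} → Star c 1 g w N → Win g
star₁-win c {g} {w} {N} st with mod3 c | count-suc⇒true N (Star.spoke-count st)
... | 3t t   | _ = star-3t-win t st
... | 3t+1 t | p , np = win (edgeMove w p (star-spoke-edge st np)) (star₀-3t+1-lose t (star-delSpoke st refl np))
... | 3t+2 t | p , np =
  let (vp , p≢w) = remove-true⁻ (V g) (Star.spokes⊆ st p np)
  in win (vertexMove p vp) (star₀-3t+1-lose t (star-delVertex st refl vp p≢w (count-remove-suc N np (Star.spoke-count st))))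

mutual
  star₂-3t+2-lose : ∀ t {g : Graph m} {w N} → Star (suc (suc (t * 3))) 2 g w N → Lose g
  star₂-3t+2-lose t {g} {w} {N} st = lose respond
    where
    open Star st
    reply-delHub : ∀ {a b} → remove (V g) w a ≡ true → remove (V g) w b ≡ true → a ≢ b → Win (delEdge g a b)
    reply-delHub ca cb a≢b =
      let cme = star-delEdge-delHub st ca cb a≢b refl
      in win (vertexMove w hub-present)
             (twins-lose (cliqueMinusEdge-twins cme) (clique-3t-lose t (cliqueMinusEdge-delVertices cme)))

    respond : ∀ {g′} → Move g g′ → Win g′
    respond (vertexMove u vu) with u ≟ w
    ... | yes refl = clique-3t+2-win t (star-delHub st)
    ... | no u≢w with N u in nu
    ...   | true  = star₁-win _ (star-delVertex st refl vu u≢w (count-remove-suc N nu spoke-count))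
    ...   | false = star₂-3t+1-win t (star-delVertex st refl vu u≢w (trans (count-cong _ _ (remove-absent N u nu)) spoke-count))
    respond (edgeMove a b eab) with star-edge-cases st eab
    ... | inj₁ (refl , nb) = star₁-win _ (star-delSpoke st refl nb)
    ... | inj₂ (inj₁ (refl , na)) = Win-≈ (delEdge-comm g w a) (star₁-win _ (star-delSpoke st refl na))
    ... | inj₂ (inj₂ (ca , cb , a≢b)) with N a in na | N b in nb
    ...   | true  | true  = twins-win (star-twins st ca cb a≢b (trans na (sym nb)))
                              (star-3t-win t (star-delVertices st ca cb a≢b refl (count-remove₂ N na nb a≢b spoke-count)))
    ...   | false | false = twins-win (star-twins st ca cb a≢b (trans na (sym nb)))
                              (star-3t-win t (star-delVertices st ca cb a≢b refl (trans (count-remove₂-absent N na nb) spoke-count)))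
    ...   | true  | false = reply-delHub ca cb a≢b
    ...   | false | true  = reply-delHub ca cb a≢b

  star₂-3t+1-win : ∀ t {g : Graph m} {w N} → Star (suc (t * 3)) 2 g w N → Win g
  star₂-3t+1-win zero st with star-non-spokes st
  ... | ()
  star₂-3t+1-win (suc t) {g} {w} {N} st
    with count-suc-suc⇒two (λ z → remove (V g) w z ∧ not (N z)) (suc-injective (suc-injective (star-non-spokes st)))
  ... | a , b , a-non-spoke , b-non-spoke , a≢b =
    let ca = ∧-conicalˡ _ _ a-non-spoke
        cb = ∧-conicalˡ _ _ b-non-spoke
        na = not-true⇒false (∧-conicalʳ (remove (V g) w a) _ a-non-spoke)
        nb = not-true⇒false (∧-conicalʳ (remove (V g) w b) _ b-non-spoke)
    in win (edgeMove a b (star-clique-edge st ca cb a≢b))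
           (twins-lose (star-twins st ca cb a≢b (trans na (sym nb)))
             (star₂-3t+2-lose t (star-delVertices st ca cb a≢b refl (trans (count-remove₂-absent N na nb) (Star.spoke-count st)))))

-- The graphs 𝒦ₙⁱ

hub : ∀ n → Fin (n + 1)
hub n = n ↑ʳ zero

spokes : ∀ n → ℕ → Fin (n + 1) → Bool
spokes n i a = [ (λ p → toℕ p <ᵇ i) , (λ _ → false) ]′ (splitAt n a)

module _ (n : ℕ) where

  splitAt-inj₂⇒hub : {a : Fin (n + 1)} {q : Fin 1} → splitAt n a ≡ inj₂ q → (a == hub n) ≡ true
  splitAt-inj₂⇒hub {a} {zero} e rewrite sym (splitAt⁻¹-↑ʳ e) = ==-refl _

  splitAt-inj₁⇒¬hub : {a : Fin (n + 1)} {p : Fin n} → splitAt n a ≡ inj₁ p → (a == hub n) ≡ false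
  splitAt-inj₁⇒¬hub {a} {p} e = ==-≢ λ a≡hub → <-irrefl refl (subst (_< n) (trans (sym (toℕ-↑ˡ p 1))
     (trans (cong toℕ (trans (splitAt⁻¹-↑ˡ e) a≡hub)) (trans (toℕ-↑ʳ n zero) (+-identityʳ n)))) (toℕ<n p))

  splitAt-inj₁-== : {a b : Fin (n + 1)} {p q : Fin n} → splitAt n a ≡ inj₁ p → splitAt n b ≡ inj₁ q → (a == b) ≡ (p == q)
  splitAt-inj₁-== {p = p} {q} ea eb rewrite sym (splitAt⁻¹-↑ˡ ea) | sym (splitAt⁻¹-↑ˡ eb) with p ≟ q
  ... | yes refl = ==-refl _
  ... | no p≢q   = ==-≢ λ e → p≢q (↑ˡ-injective 1 p q e)

K-star : ∀ n i → i ≤ n → Star n i (K n [ i ]) (hub n) (spokes n i)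
K-star n i i≤n = record
  { hub-present = refl ; clique-order = clique-order ; spoke-count = spoke-count
  ; spokes⊆ = spokes⊆ ; adjacency = adjacency }
  where
  clique-order : count (λ a → true ∧ not (a == hub n)) ≡ n
  clique-order = trans (count-↑ n 1 _) (trans (cong₂ _+_
    (trans (count-cong _ _ (λ p → cong not (splitAt-inj₁⇒¬hub n (splitAt-↑ˡ n p 1)))) (count-true n))
    (cong (λ x → b2n (not x) + 0) (==-refl (hub n)))) (+-identityʳ n))

  spoke-count : count (spokes n i) ≡ i
  spoke-count = trans (count-↑ n 1 _) (trans (cong₂ _+_
    (trans (count-cong _ _ (λ p → cong [ (λ p → toℕ p <ᵇ i) , (λ _ → false) ]′ (splitAt-↑ˡ n p 1))) (count-<ᵇ n i i≤n))
    (cong (λ x → b2n ([ (λ p → toℕ p <ᵇ i) , (λ _ → false) ]′ x) + 0) (splitAt-↑ʳ n 1 zero))) (+-identityʳ i))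

  spokes⊆ : spokes n i ⊆ᵇ remove (V (K n [ i ])) (hub n)
  spokes⊆ a e with splitAt n a in ea
  ... | inj₁ p rewrite splitAt-inj₁⇒¬hub n ea = refl

  adjacency : ∀ a b → Kadj n [ i ] a b ≡
    (((true ∧ not (a == hub n)) ∧ (true ∧ not (b == hub n)) ∧ not (a == b)) ∨ (a == hub n ∧ spokes n i b) ∨ (b == hub n ∧ spokes n i a))
  adjacency a b with splitAt n a in ea | splitAt n b in eb
  ... | inj₁ p    | inj₁ q    rewrite splitAt-inj₁⇒¬hub n ea | splitAt-inj₁⇒¬hub n eb | splitAt-inj₁-== n ea eb = sym (∨-identityʳ _)
  ... | inj₁ p    | inj₂ zero rewrite splitAt-inj₁⇒¬hub n ea | splitAt-inj₂⇒hub n eb = refl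
  ... | inj₂ zero | inj₁ q    rewrite splitAt-inj₂⇒hub n ea | splitAt-inj₁⇒¬hub n eb = sym (∨-identityʳ _)
  ... | inj₂ zero | inj₂ zero rewrite splitAt-inj₂⇒hub n ea | splitAt-inj₂⇒hub n eb = refl

SecondPlayerWins : ℕ → ℕ → Set
SecondPlayerWins c i = (i ≡ 0 × c % 3 ≡ 1) ⊎ (i ≡ 2 × c % 3 ≡ 2)

star-lose : ∀ {c i} {g : Graph m} {w N} → Star c i g w N → SecondPlayerWins c i → Lose g
star-lose {c = c} st losing with mod3 c | losing
... | 3t t   | inj₁ (refl , c%3≡1) with trans (sym (+-*3-%3 0 t)) c%3≡1
...   | ()
star-lose st losing | 3t+1 t | inj₁ (refl , _) = star₀-3t+1-lose t st
star-lose st losing | 3t+2 t | inj₁ (refl , c%3≡1) with trans (sym (+-*3-%3 2 t)) c%3≡1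
...   | ()
star-lose st losing | 3t t   | inj₂ (refl , c%3≡2) with trans (sym (+-*3-%3 0 t)) c%3≡2
...   | ()
star-lose st losing | 3t+1 t | inj₂ (refl , c%3≡2) with trans (sym (+-*3-%3 1 t)) c%3≡2
...   | ()
star-lose st losing | 3t+2 t | inj₂ (refl , _) = star₂-3t+2-lose t st

star-win : ∀ {c i} {g : Graph m} {w N} → i ≤ 2 → Star c i g w N → ¬ SecondPlayerWins c i → Win g
star-win {c = c} i≤2 st winning with mod3 c
star-win _ st _ | 3t t = star-3t-win t st
star-win {i = 0} _ st winning | 3t+1 t = ⊥-elim (winning (inj₁ (refl , +-*3-%3 1 t)))
star-win {i = 0} _ st _ | 3t+2 t = star₀-3t+2-win t st
star-win {i = 1} _ st _ | _ = star₁-win _ st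
star-win {i = 2} _ st _ | 3t+1 t = star₂-3t+1-win t st
star-win {i = 2} _ st winning | 3t+2 t = ⊥-elim (winning (inj₂ (refl , +-*3-%3 2 t)))
star-win {i = suc (suc (suc _))} (s≤s (s≤s ())) _ _ | _

lemma4p3 : (n i : ℕ) → i ≤ 2 → i ≤ n →
    (((i ≡ 0 × n % 3 ≡ 1) ⊎ (i ≡ 2 × n % 3 ≡ 2)) → Lose (K n [ i ]))
    × (¬ ((i ≡ 0 × n % 3 ≡ 1) ⊎ (i ≡ 2 × n % 3 ≡ 2)) → Win (K n [ i ]))
lemma4p3 n i i≤2 i≤n = star-lose (K-star n i i≤n) , star-win i≤2 (K-star n i i≤n)
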